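{- If $G$ is an Eulerian graph and $|E(G)|$ is odd, then $G$ has no cyclic interval $t$-coloring for any even positive integer $t$.
   Context: All graphs are finite and undirected; multiple edges are allowed, loops are not. A graph is Eulerian if every vertex has even degree. A proper $t$-edge coloring of $G$ is a map $\alpha:E(G)\to\{1,\dots,t\}$ with $\alpha(e)\neq\alpha(e')$ for adjacent edges $e,e'$; $S(v,\alpha)$ is the set of colors on edges incident to $v$. A proper $t$-edge coloring $\alpha$ is a cyclic interval $t$-coloring if for every vertex $v$, either $S(v,\alpha)$ or $\{1,\dots,t\}\setminus S(v,\alpha)$ is a set of consecutive integers. -}

module Defs where

open import Data.Nat using (ℕ; zero; suc; _+_; _≤_)
open import Data.Nat.Divisibility using (_∣_)
open import Data.Fin using (Fin; _≟_)
open import Data.Bool using (if_then_else_)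
open import Data.Product using (Σ; ∃; _×_; _,_)
open import Data.Sum using (_⊎_)
open import Relation.Nullary using (¬_)
open import Relation.Nullary.Decidable using (⌊_⌋)
open import Relation.Binary.PropositionalEquality using (_≡_; _≢_)

record Graph : Set where
  field
    n    : ℕ
    m    : ℕ
    end₁ : Fin m → Fin n
    end₂ : Fin m → Fin n
    loopless : ∀ e → end₁ e ≢ end₂ e

open Graph public

sumFin : ∀ {k} → (Fin k → ℕ) → ℕ
sumFin {zero}  f = 0
sumFin {suc k} f = f Fin.zero + sumFin (λ i → f (Fin.suc i))

Incident : (G : Graph) → Fin (m G) → Fin (n G) → Set
Incident G e x = (end₁ G e ≡ x) ⊎ (end₂ G e ≡ x)

-- degree of x: number of edges incident to x (no loops, so each counts once)
degree : (G : Graph) → Fin (n G) → ℕ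
degree G x = sumFin (λ e → (if ⌊ end₁ G e ≟ x ⌋ then 1 else 0)
                         + (if ⌊ end₂ G e ≟ x ⌋ then 1 else 0))

Even : ℕ → Set
Even k = 2 ∣ k

Odd : ℕ → Set
Odd k = ¬ Even k

Eulerian : Graph → Set
Eulerian G = ∀ x → Even (degree G x)

Adjacent : (G : Graph) → Fin (m G) → Fin (m G) → Set
Adjacent G e e' = e ≢ e' × ∃ λ x → Incident G e x × Incident G e' x

record ProperColoring (G : Graph) (t : ℕ) : Set where
  field
    α      : Fin (m G) → ℕ
    range  : ∀ e → 1 ≤ α e × α e ≤ t
    proper : ∀ e e' → Adjacent G e e' → α e ≢ α e'

open ProperColoring public

S : ∀ {G t} → ProperColoring G t → Fin (n G) → ℕ → Set
S {G} c x col = ∃ λ e → Incident G e x × α c e ≡ col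

-- a set of integers (given as a predicate on ℕ) is a set of consecutive
-- integers: it equals {a, a+1, …, b} for some a, b (empty allowed when b < a)
Consecutive : (ℕ → Set) → Set
Consecutive P = Σ ℕ λ a → Σ ℕ λ b → ∀ c → (P c → a ≤ c × c ≤ b) × (a ≤ c × c ≤ b → P c)

Complement : ℕ → (ℕ → Set) → ℕ → Set
Complement t P c = (1 ≤ c × c ≤ t) × ¬ P c

IsCyclicInterval : ∀ {G t} → ProperColoring G t → Set
IsCyclicInterval {G} {t} c =
  ∀ x → Consecutive (S c x) ⊎ Consecutive (Complement t (S c x))

-- A run of even length contains as
-- many odd as even integers, and so does {1,…,t} for even t; as deg x is even, in either
-- case S(x) has as many odd as even colours. Summing over the vertices counts every edge
-- twice, so as many edges have an odd colour as an even one, and |E(G)| is even.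
module Submission where

open import Defs
open import Data.Nat using (ℕ; _≤_)
open import Data.Product using (Σ)
open import Relation.Nullary using (¬_)

open import Data.Bool using (if_then_else_)
open import Data.Empty using (⊥-elim)
open import Data.Fin using (Fin; zero; suc; _≟_)
open import Data.Fin.Properties using (any?; suc-injective)
open import Data.Nat as ℕ using (zero; suc; _+_; _*_; _<_; _≤?_; s≤s)
open import Data.Nat.Divisibility using (divides; ∣m+n∣m⇒∣n)
open import Data.Nat.Properties
  using (≤-refl; ≤-reflexive; ≤-trans; ≤-antisym; <-≤-trans; <⇒≤; <⇒≱; m<1+n⇒m≤n;
         m≤n⇒m≤1+n; m≤m+n; m<m+n; +-monoʳ-≤; m≤n⇒∃[o]m+o≡n; m+[n∸m]≡n;
         +-comm; +-assoc; +-suc; +-identityʳ; +-cancelˡ-≡; +-cancelʳ-≡;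
         *-comm; *-assoc; *-identityˡ; *-identityʳ; *-zeroʳ; *-distribˡ-+; *-cancelˡ-≡;
         +-commutativeSemigroup; +-*-semiring)
open import Data.Product using (∃₂; _×_; _,_; proj₁; proj₂)
open import Data.Sum using (_⊎_; inj₁; inj₂; [_,_])
open import Relation.Nullary using (Dec; yes; no)
open import Relation.Nullary.Decidable using (⌊_⌋)
open import Relation.Binary.PropositionalEquality
  using (_≡_; _≢_; refl; sym; trans; cong; cong₂; subst; module ≡-Reasoning)
open import Function using (_∘_)
open import Algebra.Properties.CommutativeSemigroup +-commutativeSemigroup
  using (x∙yz≈y∙xz; xy∙z≈xz∙y)
open import Algebra.Properties.Semiring.Sum +-*-semiring
  using (sum; sum-syntax; sum-cong-≗; sum-replicate-zero; ∑-distrib-+; ∑-comm;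
         *-distribˡ-sum; *-distribʳ-sum)

open ≡-Reasoning

IsIndicator : ℕ → Set → Set
IsIndicator k P = (P × k ≡ 1) ⊎ (¬ P × k ≡ 0)

𝟙 : {P : Set} → Dec P → ℕ
𝟙 d = if ⌊ d ⌋ then 1 else 0

𝟙-isIndicator : {P : Set} (d : Dec P) → IsIndicator (𝟙 d) P
𝟙-isIndicator (yes p) = inj₁ (p , refl)
𝟙-isIndicator (no ¬p) = inj₂ (¬p , refl)

module _ {k : ℕ} {P : Set} (ind : IsIndicator k P) where

  indicator-yes : P → k ≡ 1
  indicator-yes p = [ proj₂ , (λ (¬p , _) → ⊥-elim (¬p p)) ] ind

  indicator-no : ¬ P → k ≡ 0
  indicator-no ¬p = [ (λ (p , _) → ⊥-elim (¬p p)) , proj₂ ] ind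

  isIndicator⇒dec : Dec P
  isIndicator⇒dec = [ (λ (p , _) → yes p) , (λ (¬p , _) → no ¬p) ] ind

  isIndicator-map : {Q : Set} → (P → Q) → (¬ P → ¬ Q) → IsIndicator k Q
  isIndicator-map to from = [ (λ (p , eq) → inj₁ (to p , eq)) , (λ (¬p , eq) → inj₂ (from ¬p , eq)) ] ind

isIndicator-+ : ∀ {j k} {A B : Set} → IsIndicator j A → IsIndicator k B → ¬ (A × B) →
  IsIndicator (j + k) (A ⊎ B)
isIndicator-+ (inj₁ (a , refl)) (inj₁ (b , refl)) disjoint = ⊥-elim (disjoint (a , b))
isIndicator-+ (inj₁ (a , refl)) (inj₂ (_ , refl)) _ = inj₁ (inj₁ a , refl)
isIndicator-+ (inj₂ (_ , refl)) (inj₁ (b , refl)) _ = inj₁ (inj₂ b , refl)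
isIndicator-+ (inj₂ (¬a , refl)) (inj₂ (¬b , refl)) _ = inj₂ ([ ¬a , ¬b ] , refl)

isIndicator-* : ∀ {j k} {A B : Set} → IsIndicator j A → IsIndicator k B →
  IsIndicator (j * k) (A × B)
isIndicator-* (inj₁ (a , refl)) (inj₁ (b , refl)) = inj₁ ((a , b) , refl)
isIndicator-* (inj₁ (_ , refl)) (inj₂ (¬b , refl)) = inj₂ ((λ (_ , b) → ¬b b) , refl)
isIndicator-* (inj₂ (¬a , refl)) _ = inj₂ ((λ (a , _) → ¬a a) , refl)

sumFin≡sum : ∀ {k} (f : Fin k → ℕ) → sumFin f ≡ sum f
sumFin≡sum {zero}  f = refl
sumFin≡sum {suc k} f = cong (f zero +_) (sumFin≡sum (λ i → f (suc i)))

sum-zero : ∀ {k} {f : Fin k → ℕ} → (∀ i → f i ≡ 0) → sum f ≡ 0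
sum-zero {k} f≡0 = trans (sum-cong-≗ f≡0) (sum-replicate-zero k)

sum-single : ∀ {k} (f : Fin k → ℕ) i → (∀ j → j ≢ i → f j ≡ 0) → sum f ≡ f i
sum-single f zero f≡0 =
  trans (cong (f zero +_) (sum-zero (λ j → f≡0 (suc j) (λ ())))) (+-identityʳ (f zero))
sum-single f (suc i) f≡0 =
  trans (cong (_+ sum (λ j → f (suc j))) (f≡0 zero (λ ())))
        (sum-single (λ j → f (suc j)) i (λ j j≢i → f≡0 (suc j) (j≢i ∘ suc-injective)))

∑-const : ∀ k c → ∑[ i < k ] c ≡ k * c
∑-const zero    c = refl
∑-const (suc k) c = cong (c +_) (∑-const k c)

∑-𝟙≟ : ∀ {k} (v : Fin k) → ∑[ x < k ] 𝟙 (v ≟ x) ≡ 1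
∑-𝟙≟ v = trans (sum-single _ v (λ x x≢v → indicator-no (𝟙-isIndicator (v ≟ x)) (x≢v ∘ sym)))
               (indicator-yes (𝟙-isIndicator (v ≟ v)) refl)

-- Sums over runs of consecutive integers

runSum : ℕ → ℕ → (ℕ → ℕ) → ℕ
runSum a zero    f = 0
runSum a (suc l) f = f a + runSum (suc a) l f

InRun : ℕ → ℕ → ℕ → Set
InRun a l c = a ≤ c × c < a + l

runSum-cong : ∀ a l {f g : ℕ → ℕ} → (∀ c → InRun a l c → f c ≡ g c) →
  runSum a l f ≡ runSum a l g
runSum-cong a zero    f≡g = refl
runSum-cong a (suc l) f≡g =
  cong₂ _+_ (f≡g a (≤-refl , m<m+n a (s≤s ℕ.z≤n)))
            (runSum-cong (suc a) l (λ c (a<c , c<) →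
               f≡g c (<⇒≤ a<c , subst (c <_) (sym (+-suc a l)) c<)))

runSum-const : ∀ a l k → runSum a l (λ _ → k) ≡ l * k
runSum-const a zero    k = refl
runSum-const a (suc l) k = cong (k +_) (runSum-const (suc a) l k)

runSum-zero : ∀ a l {f : ℕ → ℕ} → (∀ c → InRun a l c → f c ≡ 0) → runSum a l f ≡ 0
runSum-zero a l f≡0 = trans (runSum-cong a l f≡0) (trans (runSum-const a l 0) (*-zeroʳ l))

runSum-++ : ∀ a l₁ l₂ f → runSum a (l₁ + l₂) f ≡ runSum a l₁ f + runSum (a + l₁) l₂ f
runSum-++ a zero    l₂ f = cong (λ b → runSum b l₂ f) (sym (+-identityʳ a))
runSum-++ a (suc l₁) l₂ f = begin
  f a + runSum (suc a) (l₁ + l₂) f                        ≡⟨ cong (f a +_) (runSum-++ (suc a) l₁ l₂ f) ⟩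
  f a + (runSum (suc a) l₁ f + runSum (suc a + l₁) l₂ f)  ≡⟨ sym (+-assoc (f a) _ _) ⟩
  f a + runSum (suc a) l₁ f + runSum (suc a + l₁) l₂ f    ≡⟨ cong (λ b → f a + runSum (suc a) l₁ f + runSum b l₂ f) (sym (+-suc a l₁)) ⟩
  f a + runSum (suc a) l₁ f + runSum (a + suc l₁) l₂ f    ∎

runSum-*ˡ : ∀ a l k f → k * runSum a l f ≡ runSum a l (λ c → k * f c)
runSum-*ˡ a zero    k f = *-zeroʳ k
runSum-*ˡ a (suc l) k f =
  trans (*-distribˡ-+ k (f a) _) (cong (k * f a +_) (runSum-*ˡ (suc a) l k f))

∑-runSum-comm : ∀ {k} a l (f : Fin k → ℕ → ℕ) →
  ∑[ i < k ] runSum a l (f i) ≡ runSum a l (λ c → ∑[ i < k ] f i c)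
∑-runSum-comm {k} a zero f = sum-zero {k} (λ _ → refl)
∑-runSum-comm a (suc l) f =
  trans (∑-distrib-+ (λ i → f i a) (λ i → runSum (suc a) l (f i)))
        (cong (_ +_) (∑-runSum-comm (suc a) l f))

runSum-around : ∀ {b k a l} → b ≤ a → a + l ≤ b + k → ∃₂ λ d r →
  (∀ f → runSum b k f ≡ runSum b d f + runSum a l f + runSum (a + l) r f) ×
  (∀ {c} → InRun b d c ⊎ InRun (a + l) r c → InRun b k c × ¬ InRun a l c)
runSum-around {b} {k} {a} {l} b≤a a+l≤b+k
  with d , refl ← m≤n⇒∃[o]m+o≡n b≤a
  with r , b+d+l+r≡b+k ← m≤n⇒∃[o]m+o≡n a+l≤b+k = d , r , split , outside
  where
  k≡d+l+r : k ≡ d + l + r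
  k≡d+l+r = +-cancelˡ-≡ b k (d + l + r) (begin
    b + k            ≡⟨ sym b+d+l+r≡b+k ⟩
    b + d + l + r    ≡⟨ cong (_+ r) (+-assoc b d l) ⟩
    b + (d + l) + r  ≡⟨ +-assoc b (d + l) r ⟩
    b + (d + l + r)  ∎)

  split : ∀ f → runSum b k f ≡ runSum b d f + runSum (b + d) l f + runSum (b + d + l) r f
  split f rewrite k≡d+l+r =
    trans (runSum-++ b (d + l) r f)
          (cong₂ (λ s u → s + runSum u r f) (runSum-++ b d l f) (sym (+-assoc b d l)))

  b+d+l+r≤b+k : b + d + l + r ≤ b + k
  b+d+l+r≤b+k = ≤-reflexive b+d+l+r≡b+k

  outside : ∀ {c} → InRun b d c ⊎ InRun (b + d + l) r c → InRun b k c × ¬ InRun (b + d) l c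
  outside (inj₁ (b≤c , c<b+d)) =
    (b≤c , <-≤-trans c<b+d (≤-trans (≤-trans (m≤m+n (b + d) l) (m≤m+n _ r)) b+d+l+r≤b+k))
    , λ (b+d≤c , _) → <⇒≱ c<b+d b+d≤c
  outside (inj₂ (b+d+l≤c , c<)) =
    (≤-trans (≤-trans (m≤m+n b d) (m≤m+n (b + d) l)) b+d+l≤c , <-≤-trans c< b+d+l+r≤b+k)
    , λ (_ , c<b+d+l) → <⇒≱ c<b+d+l b+d+l≤c

runSum-restrict : ∀ {b k a l} {f g : ℕ → ℕ} → b ≤ a → a + l ≤ b + k →
  (∀ c → InRun b k c → ¬ InRun a l c → f c ≡ 0) → (∀ c → InRun a l c → f c ≡ g c) →
  runSum b k f ≡ runSum a l g
runSum-restrict {b} {k} {a} {l} {f} {g} b≤a a+l≤b+k f≡0 f≡g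
  with d , r , split , outside ← runSum-around b≤a a+l≤b+k = begin
  runSum b k f                                      ≡⟨ split f ⟩
  runSum b d f + runSum a l f + runSum (a + l) r f  ≡⟨ cong₂ (λ x y → x + runSum a l f + y)
                                                       (runSum-zero b d λ c → vanish c ∘ inj₁)
                                                       (runSum-zero (a + l) r λ c → vanish c ∘ inj₂) ⟩
  runSum a l f + 0                                  ≡⟨ +-identityʳ _ ⟩
  runSum a l f                                      ≡⟨ runSum-cong a l f≡g ⟩
  runSum a l g                                      ∎
  where
  vanish : ∀ c → InRun b d c ⊎ InRun (a + l) r c → f c ≡ 0
  vanish c c∈ = let (inside , notSub) = outside c∈ in f≡0 c inside notSub

runSum-complement : ∀ {b k a l} {f g : ℕ → ℕ} → b ≤ a → a + l ≤ b + k →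
  (∀ c → InRun b k c → ¬ InRun a l c → f c ≡ g c) → (∀ c → InRun a l c → f c ≡ 0) →
  runSum b k f + runSum a l g ≡ runSum b k g
runSum-complement {b} {k} {a} {l} {f} {g} b≤a a+l≤b+k f≡g f≡0
  with d , r , split , outside ← runSum-around b≤a a+l≤b+k = begin
  runSum b k f + runSum a l g                                       ≡⟨ cong (_+ _) (split f) ⟩
  runSum b d f + runSum a l f + runSum (a + l) r f + runSum a l g   ≡⟨ cong₂ (λ x y → x + y + runSum a l g)
                                                                       (cong₂ _+_ (agree inj₁) (runSum-zero a l f≡0))
                                                                       (agree inj₂) ⟩
  runSum b d g + 0 + runSum (a + l) r g + runSum a l g              ≡⟨ cong (λ x → x + runSum (a + l) r g + runSum a l g) (+-identityʳ _) ⟩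
  runSum b d g + runSum (a + l) r g + runSum a l g                  ≡⟨ xy∙z≈xz∙y (runSum b d g) _ _ ⟩
  runSum b d g + runSum a l g + runSum (a + l) r g                  ≡⟨ sym (split g) ⟩
  runSum b k g                                                      ∎
  where
  agree : ∀ {s u} → (∀ {c} → InRun s u c → InRun b d c ⊎ InRun (a + l) r c) →
    runSum s u f ≡ runSum s u g
  agree {s} {u} piece = runSum-cong s u (λ c c∈ →
    let (inside , notSub) = outside (piece c∈) in f≡g c inside notSub)

runSum-pick : ∀ {a l k} (g : ℕ → ℕ) → InRun a l k →
  runSum a l (λ c → 𝟙 (k ℕ.≟ c) * g c) ≡ g k
runSum-pick {a} {l} {k} g (a≤k , k<a+l) =
  trans (runSum-restrict a≤k (subst (_≤ a + l) (+-comm 1 k) k<a+l) off on) (+-identityʳ (g k))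
  where
  off : ∀ c → InRun a l c → ¬ InRun k 1 c → 𝟙 (k ℕ.≟ c) * g c ≡ 0
  off c _ c∉ = cong (_* g c) (indicator-no (𝟙-isIndicator (k ℕ.≟ c)) λ { refl → c∉ (≤-refl , ≤-reflexive (+-comm 1 k)) })

  on : ∀ c → InRun k 1 c → 𝟙 (k ℕ.≟ c) * g c ≡ g c
  on c (k≤c , c<k+1) =
    trans (cong (_* g c) (indicator-yes (𝟙-isIndicator (k ℕ.≟ c))
                           (≤-antisym k≤c (m<1+n⇒m≤n (subst (c <_) (+-comm k 1) c<k+1)))))
          (*-identityˡ (g c))

-- Parity balance of runs

χ-odd : ℕ → ℕ
χ-odd zero          = 0
χ-odd (suc zero)    = 1
χ-odd (suc (suc c)) = χ-odd c

χ-even : ℕ → ℕ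
χ-even c = χ-odd (suc c)

χ-odd+χ-even : ∀ c → χ-odd c + χ-even c ≡ 1
χ-odd+χ-even zero          = refl
χ-odd+χ-even (suc zero)    = refl
χ-odd+χ-even (suc (suc c)) = χ-odd+χ-even c

Balanced : ℕ → ℕ → (ℕ → ℕ) → Set
Balanced b k h = runSum b k (λ c → h c * χ-odd c) ≡ runSum b k (λ c → h c * χ-even c)

evenRun-balanced : ∀ a l → Even l → runSum a l χ-odd ≡ runSum a l χ-even
evenRun-balanced a _ (divides q refl) = go a q
  where
  go : ∀ a q → runSum a (q * 2) χ-odd ≡ runSum a (q * 2) χ-even
  go a zero    = refl
  go a (suc q) = trans (cong (λ s → χ-odd a + (χ-even a + s)) (go (suc (suc a)) q))
                       (x∙yz≈y∙xz (χ-odd a) (χ-even a) _)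

module _ {b k a l : ℕ} {h : ℕ → ℕ} (b≤a : b ≤ a) (a+l≤b+k : a + l ≤ b + k) where

  subrun-balanced : (∀ c → IsIndicator (h c) (InRun a l c)) → Even (runSum b k h) →
    Balanced b k h
  subrun-balanced h-ind even-h =
    trans (restricted χ-odd) (trans (evenRun-balanced a l even-l) (sym (restricted χ-even)))
    where
    restricted : ∀ g → runSum b k (λ c → h c * g c) ≡ runSum a l g
    restricted g = runSum-restrict b≤a a+l≤b+k
      (λ c _ c∉ → cong (_* g c) (indicator-no (h-ind c) c∉))
      (λ c c∈ → trans (cong (_* g c) (indicator-yes (h-ind c) c∈)) (*-identityˡ (g c)))

    even-l : Even l
    even-l = subst Even size even-h
      where
      size : runSum b k h ≡ l
      size = begin
        runSum b k h                  ≡⟨ runSum-cong b k (λ c _ → sym (*-identityʳ (h c))) ⟩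
        runSum b k (λ c → h c * 1)    ≡⟨ restricted (λ _ → 1) ⟩
        runSum a l (λ _ → 1)          ≡⟨ runSum-const a l 1 ⟩
        l * 1                         ≡⟨ *-identityʳ l ⟩
        l                             ∎

  cosubrun-balanced : Even k → (∀ c → InRun b k c → IsIndicator (h c) (¬ InRun a l c)) →
    Even (runSum b k h) → Balanced b k h
  cosubrun-balanced even-k h-ind even-h = +-cancelʳ-≡ (runSum a l χ-odd) _ _ (begin
    runSum b k (λ c → h c * χ-odd c) + runSum a l χ-odd    ≡⟨ completed χ-odd ⟩
    runSum b k χ-odd                                       ≡⟨ evenRun-balanced b k even-k ⟩
    runSum b k χ-even                                      ≡⟨ sym (completed χ-even) ⟩
    runSum b k (λ c → h c * χ-even c) + runSum a l χ-even  ≡⟨ cong (_ +_) (sym (evenRun-balanced a l even-l)) ⟩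
    runSum b k (λ c → h c * χ-even c) + runSum a l χ-odd   ∎)
    where
    completed : ∀ g → runSum b k (λ c → h c * g c) + runSum a l g ≡ runSum b k g
    completed g = runSum-complement b≤a a+l≤b+k
      (λ c c∈ c∉ → trans (cong (_* g c) (indicator-yes (h-ind c c∈) c∉)) (*-identityˡ (g c)))
      (λ c c∈ → cong (_* g c) (indicator-no (h-ind c (inRun c∈)) (λ c∉ → c∉ c∈)))
      where
      inRun : ∀ {c} → InRun a l c → InRun b k c
      inRun (a≤c , c<a+l) = ≤-trans b≤a a≤c , <-≤-trans c<a+l a+l≤b+k

    even-l : Even l
    even-l = ∣m+n∣m⇒∣n (subst Even (sym size) even-k) even-h
      where
      size : runSum b k h + l ≡ k
      size = begin
        runSum b k h + l                                    ≡⟨ cong₂ _+_ (runSum-cong b k (λ c _ → sym (*-identityʳ (h c))))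
                                                                          (sym (trans (runSum-const a l 1) (*-identityʳ l))) ⟩
        runSum b k (λ c → h c * 1) + runSum a l (λ _ → 1)  ≡⟨ completed (λ _ → 1) ⟩
        runSum b k (λ _ → 1)                                ≡⟨ runSum-const b k 1 ⟩
        k * 1                                               ≡⟨ *-identityʳ k ⟩
        k                                                   ∎

consecutive⇒run : ∀ {P : ℕ → Set} {b k} → Consecutive P → (∀ {c} → P c → InRun b k c) →
  ∃₂ λ a l → b ≤ a × a + l ≤ b + k × (∀ {c} → P c → InRun a l c) × (∀ {c} → InRun a l c → P c)
consecutive⇒run {P} {b} {k} (a , z , P⇔) P⊆ with a ≤? z
... | yes a≤z = a , suc z ℕ.∸ a , proj₁ (P⊆ Pa) , bound , to , from
  where
  a+l≡1+z : a + (suc z ℕ.∸ a) ≡ suc z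
  a+l≡1+z = m+[n∸m]≡n (m≤n⇒m≤1+n a≤z)

  Pa : P a
  Pa = proj₂ (P⇔ a) (≤-refl , a≤z)

  bound : a + (suc z ℕ.∸ a) ≤ b + k
  bound = subst (_≤ b + k) (sym a+l≡1+z) (proj₂ (P⊆ (proj₂ (P⇔ z) (a≤z , ≤-refl))))

  to : ∀ {c} → P c → InRun a (suc z ℕ.∸ a) c
  to {c} Pc = let (a≤c , c≤z) = proj₁ (P⇔ c) Pc in a≤c , subst (c <_) (sym a+l≡1+z) (s≤s c≤z)

  from : ∀ {c} → InRun a (suc z ℕ.∸ a) c → P c
  from {c} (a≤c , c<) = proj₂ (P⇔ c) (a≤c , m<1+n⇒m≤n (subst (c <_) a+l≡1+z c<))
... | no a≰z = b , 0 , ≤-refl , +-monoʳ-≤ b ℕ.z≤n , to , from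
  where
  to : ∀ {c} → P c → InRun b 0 c
  to {c} Pc = let (a≤c , c≤z) = proj₁ (P⇔ c) Pc in ⊥-elim (a≰z (≤-trans a≤c c≤z))

  from : ∀ {c} → InRun b 0 c → P c
  from (b≤c , c<b+0) = ⊥-elim (<⇒≱ (subst (_ <_) (+-identityʳ b) c<b+0) b≤c)

cyclicInterval-balanced : ∀ {t} {T : ℕ → Set} {h : ℕ → ℕ} → Even t →
  (∀ c → IsIndicator (h c) (T c)) → (∀ {c} → T c → InRun 1 t c) →
  Consecutive T ⊎ Consecutive (Complement t T) → Even (runSum 1 t h) → Balanced 1 t h
cyclicInterval-balanced _ h-ind T⊆ (inj₁ T-cons) even-h
  with a , l , 1≤a , bound , to , from ← consecutive⇒run T-cons T⊆ =
  subrun-balanced 1≤a bound (λ c → isIndicator-map (h-ind c) to (λ ¬T c∈ → ¬T (from c∈))) even-h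
cyclicInterval-balanced {t} {T} even-t h-ind T⊆ (inj₂ coT-cons) even-h
  with a , l , 1≤a , bound , to , from ← consecutive⇒run coT-cons (λ ((1≤c , c≤t) , _) → 1≤c , s≤s c≤t) =
  cosubrun-balanced 1≤a bound even-t
    (λ c (1≤c , c<1+t) → isIndicator-map (h-ind c)
       (λ Tc c∈ → proj₂ (from c∈) Tc)
       (λ ¬Tc c∉ → c∉ (to ((1≤c , m<1+n⇒m≤n c<1+t) , ¬Tc))))
    even-h

-- Counting the edges at a vertex by colour

incidence : (G : Graph) → Fin (m G) → Fin (n G) → ℕ
incidence G e x = 𝟙 (end₁ G e ≟ x) + 𝟙 (end₂ G e ≟ x)

incidence-isIndicator : ∀ G e x → IsIndicator (incidence G e x) (Incident G e x)
incidence-isIndicator G e x =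
  isIndicator-+ (𝟙-isIndicator (end₁ G e ≟ x)) (𝟙-isIndicator (end₂ G e ≟ x))
                (λ (p , q) → loopless G e (trans p (sym q)))

degree≡∑incidence : ∀ G x → degree G x ≡ ∑[ e < m G ] incidence G e x
degree≡∑incidence G x = sumFin≡sum (λ e → incidence G e x)

∑incidence≡2 : ∀ G e → ∑[ x < n G ] incidence G e x ≡ 2
∑incidence≡2 G e = trans (∑-distrib-+ (λ x → 𝟙 (end₁ G e ≟ x)) (λ x → 𝟙 (end₂ G e ≟ x)))
                         (cong₂ _+_ (∑-𝟙≟ (end₁ G e)) (∑-𝟙≟ (end₂ G e)))

module _ {G : Graph} {t : ℕ} (col : ProperColoring G t) where

  multiplicity : Fin (n G) → ℕ → ℕ
  multiplicity x c = ∑[ e < m G ] (incidence G e x * 𝟙 (α col e ℕ.≟ c))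

  multiplicity-isIndicator : ∀ x c → IsIndicator (multiplicity x c) (S col x c)
  multiplicity-isIndicator x c = count (any? (isIndicator⇒dec ∘ term))
    where
    term : ∀ e → IsIndicator (incidence G e x * 𝟙 (α col e ℕ.≟ c)) (Incident G e x × α col e ≡ c)
    term e = isIndicator-* (incidence-isIndicator G e x) (𝟙-isIndicator (α col e ℕ.≟ c))

    count : Dec (S col x c) → IsIndicator (multiplicity x c) (S col x c)
    count (yes (e , e∈)) = inj₁ ((e , e∈) , trans (sum-single _ e others) (indicator-yes (term e) e∈))
      where
      others : ∀ j → j ≢ e → incidence G j x * 𝟙 (α col j ℕ.≟ c) ≡ 0
      others j j≢e = indicator-no (term j) λ (j-inc , αj≡c) →
        proper col j e (j≢e , x , j-inc , proj₁ e∈) (trans αj≡c (sym (proj₂ e∈)))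
    count (no ¬S) = inj₂ (¬S , sum-zero (λ j → indicator-no (term j) (λ j∈ → ¬S (j , j∈))))

  ∑incidence-by-colour : ∀ x (g : ℕ → ℕ) →
    ∑[ e < m G ] (incidence G e x * g (α col e)) ≡ runSum 1 t (λ c → multiplicity x c * g c)
  ∑incidence-by-colour x g = begin
    ∑[ e < m G ] (incidence G e x * g (α col e))
      ≡⟨ sum-cong-≗ (λ e → cong (incidence G e x *_) (sym (runSum-pick g (colour∈ e)))) ⟩
    ∑[ e < m G ] (incidence G e x * runSum 1 t (λ c → 𝟙 (α col e ℕ.≟ c) * g c))
      ≡⟨ sum-cong-≗ (λ e → runSum-*ˡ 1 t (incidence G e x) _) ⟩
    ∑[ e < m G ] runSum 1 t (λ c → incidence G e x * (𝟙 (α col e ℕ.≟ c) * g c))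
      ≡⟨ ∑-runSum-comm 1 t (λ e c → incidence G e x * (𝟙 (α col e ℕ.≟ c) * g c)) ⟩
    runSum 1 t (λ c → ∑[ e < m G ] (incidence G e x * (𝟙 (α col e ℕ.≟ c) * g c)))
      ≡⟨ runSum-cong 1 t (λ c _ → trans (sum-cong-≗ (λ e → sym (*-assoc (incidence G e x) _ (g c))))
                                          (sym (*-distribʳ-sum (g c) λ e → incidence G e x * 𝟙 (α col e ℕ.≟ c)))) ⟩
    runSum 1 t (λ c → multiplicity x c * g c) ∎
    where
    colour∈ : ∀ e → InRun 1 t (α col e)
    colour∈ e = let (1≤αe , αe≤t) = range col e in 1≤αe , s≤s αe≤t

  degree≡∑multiplicity : ∀ x → degree G x ≡ runSum 1 t (multiplicity x)
  degree≡∑multiplicity x = begin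
    degree G x                                      ≡⟨ degree≡∑incidence G x ⟩
    ∑[ e < m G ] incidence G e x                    ≡⟨ sum-cong-≗ (λ e → sym (*-identityʳ (incidence G e x))) ⟩
    ∑[ e < m G ] (incidence G e x * 1)              ≡⟨ ∑incidence-by-colour x (λ _ → 1) ⟩
    runSum 1 t (λ c → multiplicity x c * 1)         ≡⟨ runSum-cong 1 t (λ c _ → *-identityʳ (multiplicity x c)) ⟩
    runSum 1 t (multiplicity x)                     ∎

  vertex-balanced : IsCyclicInterval col → Eulerian G → Even t → ∀ x →
    ∑[ e < m G ] (incidence G e x * χ-odd (α col e)) ≡ ∑[ e < m G ] (incidence G e x * χ-even (α col e))
  vertex-balanced cyclic eulerian even-t x = begin
    ∑[ e < m G ] (incidence G e x * χ-odd (α col e))   ≡⟨ ∑incidence-by-colour x χ-odd ⟩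
    runSum 1 t (λ c → multiplicity x c * χ-odd c)      ≡⟨ balanced ⟩
    runSum 1 t (λ c → multiplicity x c * χ-even c)     ≡⟨ sym (∑incidence-by-colour x χ-even) ⟩
    ∑[ e < m G ] (incidence G e x * χ-even (α col e))  ∎
    where
    balanced : Balanced 1 t (multiplicity x)
    balanced = cyclicInterval-balanced even-t (multiplicity-isIndicator x) colours⊆
                 (cyclic x) (subst Even (degree≡∑multiplicity x) (eulerian x))
      where
      colours⊆ : ∀ {c} → S col x c → InRun 1 t c
      colours⊆ (e , _ , refl) = let (1≤αe , αe≤t) = range col e in 1≤αe , s≤s αe≤t

  ∑∑incidence : ∀ (g : ℕ → ℕ) →
    ∑[ x < n G ] ∑[ e < m G ] (incidence G e x * g (α col e)) ≡ 2 * ∑[ e < m G ] g (α col e)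
  ∑∑incidence g = begin
    ∑[ x < n G ] ∑[ e < m G ] (incidence G e x * g (α col e))    ≡⟨ ∑-comm (λ x e → incidence G e x * g (α col e)) ⟩
    ∑[ e < m G ] ∑[ x < n G ] (incidence G e x * g (α col e))    ≡⟨ sum-cong-≗ (λ e → sym (*-distribʳ-sum (g (α col e)) (incidence G e))) ⟩
    ∑[ e < m G ] ((∑[ x < n G ] incidence G e x) * g (α col e))  ≡⟨ sum-cong-≗ (λ e → cong (_* g (α col e)) (∑incidence≡2 G e)) ⟩
    ∑[ e < m G ] (2 * g (α col e))                               ≡⟨ sym (*-distribˡ-sum 2 (g ∘ α col)) ⟩
    2 * ∑[ e < m G ] g (α col e)                                 ∎

  edges-even : IsCyclicInterval col → Eulerian G → Even t → Even (m G)
  edges-even cyclic eulerian even-t = divides #odd (begin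
    m G                                                       ≡⟨ sym (trans (∑-const (m G) 1) (*-identityʳ (m G))) ⟩
    ∑[ e < m G ] 1                                            ≡⟨ sum-cong-≗ (λ e → sym (χ-odd+χ-even (α col e))) ⟩
    ∑[ e < m G ] (χ-odd (α col e) + χ-even (α col e))         ≡⟨ ∑-distrib-+ (χ-odd ∘ α col) (χ-even ∘ α col) ⟩
    #odd + ∑[ e < m G ] χ-even (α col e)                      ≡⟨ cong (#odd +_) (sym #odd≡#even) ⟩
    #odd + #odd                                               ≡⟨ cong (#odd +_) (sym (+-identityʳ #odd)) ⟩
    2 * #odd                                                  ≡⟨ *-comm 2 #odd ⟩
    #odd * 2                                                  ∎)
    where
    #odd : ℕ
    #odd = ∑[ e < m G ] χ-odd (α col e)

    #odd≡#even : #odd ≡ ∑[ e < m G ] χ-even (α col e)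
    #odd≡#even = *-cancelˡ-≡ _ _ 2 (begin
      2 * #odd                                                        ≡⟨ sym (∑∑incidence χ-odd) ⟩
      ∑[ x < n G ] ∑[ e < m G ] (incidence G e x * χ-odd (α col e))   ≡⟨ sum-cong-≗ (vertex-balanced cyclic eulerian even-t) ⟩
      ∑[ x < n G ] ∑[ e < m G ] (incidence G e x * χ-even (α col e))  ≡⟨ ∑∑incidence χ-even ⟩
      2 * ∑[ e < m G ] χ-even (α col e)                               ∎)

corollary9 : (G : Graph) → Eulerian G → Odd (m G) →
    (t : ℕ) → 1 ≤ t → Even t →
    ¬ (Σ (ProperColoring G t) IsCyclicInterval)
corollary9 G eulerian odd-edges t _ even-t (col , cyclic) = odd-edges (edges-even col cyclic eulerian even-t)
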